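{- For all record types $\rho_1,\rho_2\in\mathbb{T}_R$: $\rho_1+\rho_2=\rho_1\cap\rho_2$ if and only if $\rho_1+\rho_2\le\rho_1$.
   Context: Types $\mathbb{T}$: $\sigma::=a\mid\omega\mid\sigma\to\sigma\mid\sigma\cap\sigma\mid\rho$; record types $\mathbb{T}_R$: $\rho::=\langle\rangle\mid\langle l:\sigma\rangle\mid\rho+\rho\mid\rho\cap\rho$. Subtyping $\le$ is the least preorder with: $\sigma\le\omega$; $\omega\le\omega\to\omega$; $\sigma\cap\tau\le\sigma$; $\sigma\cap\tau\le\tau$; $\sigma\le\tau_1,\sigma\le\tau_2\Rightarrow\sigma\le\tau_1\cap\tau_2$; $(\sigma\to\tau_1)\cap(\sigma\to\tau_2)\le\sigma\to\tau_1\cap\tau_2$; $\sigma_2\le\sigma_1,\tau_1\le\tau_2\Rightarrow\sigma_1\to\tau_1\le\sigma_2\to\tau_2$; $\langle l:\sigma\rangle\le\langle\rangle$; $\langle l:\sigma\rangle\cap\langle l:\tau\rangle\le\langle l:\sigma\cap\tau\rangle$; $\sigma\le\tau\Rightarrow\langle l:\sigma\rangle\le\langle l:\tau\rangle$; and, with $=$ meaning mutual $\le$: $\rho+\langle\rangle=\langle\rangle+\rho=\rho$; $(\rho_1+\rho_2)+\rho_3=\rho_1+(\rho_2+\rho_3)$; $(\rho_1\cap\rho_2)+\rho_3=(\rho_1+\rho_3)\cap(\rho_2+\rho_3)$; $\langle l:\sigma\rangle+(\langle l:\tau\rangle\cap\rho)=\langle l:\tau\rangle\cap\rho$; $\langle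 l:\sigma\rangle+(\langle l':\tau\rangle\cap\rho)=\langle l':\tau\rangle\cap(\langle l:\sigma\rangle+\rho)$ if $l\ne l'$; $\rho_1\le\rho_2\Rightarrow\rho_1+\rho\le\rho_2+\rho$; $\rho_1=\rho_2\Rightarrow\rho+\rho_1=\rho+\rho_2$. -}

module Defs where

open import Data.Nat using (ℕ)
open import Data.Product using (_×_)
open import Relation.Binary.PropositionalEquality using (_≢_)

-- Atoms a and labels l are both drawn from ℕ.
-- Syntactic sort: ty = general types 𝕋, rc = record types 𝕋_R.
data Kind : Set where
  ty rc : Kind

-- Record-type constructors (⟨⟩, ⟨l:σ⟩, +, ∩) are available at both sorts,
-- so that 𝕋_R embeds into 𝕋 with ∩ on records being the ∩ of types.
data Ty : Kind → Set where
  atom  : ℕ → Ty ty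
  ω     : Ty ty
  _⇒_   : Ty ty → Ty ty → Ty ty
  _∩_   : ∀ {k} → Ty k → Ty k → Ty k
  ⟨⟩    : ∀ {k} → Ty k
  ⟨_∶_⟩ : ∀ {k} → ℕ → Ty ty → Ty k
  _⊕_   : ∀ {k} → Ty rc → Ty rc → Ty k

infixr 5 _⇒_
infixl 7 _∩_
infixl 6 _⊕_

⌊_⌋ : Ty rc → Ty ty
⌊ ρ₁ ∩ ρ₂ ⌋ = ⌊ ρ₁ ⌋ ∩ ⌊ ρ₂ ⌋
⌊ ⟨⟩ ⌋ = ⟨⟩
⌊ ⟨ l ∶ σ ⟩ ⌋ = ⟨ l ∶ σ ⟩
⌊ ρ₁ ⊕ ρ₂ ⌋ = ρ₁ ⊕ ρ₂

infix 4 _≤_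
-- Subtyping: least preorder closed under the listed rules.
-- Each equation ρ = ρ' is rendered as two rules ρ ≤ ρ' and ρ' ≤ ρ.
data _≤_ : Ty ty → Ty ty → Set where
  ≤-refl  : ∀ {σ} → σ ≤ σ
  ≤-trans : ∀ {σ τ υ} → σ ≤ τ → τ ≤ υ → σ ≤ υ
  ≤-ω     : ∀ {σ} → σ ≤ ω
  ω≤ω⇒ω   : ω ≤ (ω ⇒ ω)
  ∩-l     : ∀ {σ τ} → σ ∩ τ ≤ σ
  ∩-r     : ∀ {σ τ} → σ ∩ τ ≤ τ
  ∩-glb   : ∀ {σ τ₁ τ₂} → σ ≤ τ₁ → σ ≤ τ₂ → σ ≤ τ₁ ∩ τ₂
  ⇒-∩     : ∀ {σ τ₁ τ₂} → (σ ⇒ τ₁) ∩ (σ ⇒ τ₂) ≤ σ ⇒ (τ₁ ∩ τ₂)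
  ⇒-mono  : ∀ {σ₁ σ₂ τ₁ τ₂} → σ₂ ≤ σ₁ → τ₁ ≤ τ₂ → σ₁ ⇒ τ₁ ≤ σ₂ ⇒ τ₂
  fld≤⟨⟩  : ∀ {l σ} → ⟨ l ∶ σ ⟩ ≤ ⟨⟩
  fld-∩   : ∀ {l σ τ} → ⟨ l ∶ σ ⟩ ∩ ⟨ l ∶ τ ⟩ ≤ ⟨ l ∶ σ ∩ τ ⟩
  fld-mono : ∀ {l σ τ} → σ ≤ τ → ⟨ l ∶ σ ⟩ ≤ ⟨ l ∶ τ ⟩
  +⟨⟩₁ : ∀ {ρ} → ρ ⊕ ⟨⟩ ≤ ⌊ ρ ⌋
  +⟨⟩₂ : ∀ {ρ} → ⌊ ρ ⌋ ≤ ρ ⊕ ⟨⟩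
  ⟨⟩+₁ : ∀ {ρ} → ⟨⟩ ⊕ ρ ≤ ⌊ ρ ⌋
  ⟨⟩+₂ : ∀ {ρ} → ⌊ ρ ⌋ ≤ ⟨⟩ ⊕ ρ
  +-assoc₁ : ∀ {ρ₁ ρ₂ ρ₃} → (ρ₁ ⊕ ρ₂) ⊕ ρ₃ ≤ ρ₁ ⊕ (ρ₂ ⊕ ρ₃)
  +-assoc₂ : ∀ {ρ₁ ρ₂ ρ₃} → ρ₁ ⊕ (ρ₂ ⊕ ρ₃) ≤ (ρ₁ ⊕ ρ₂) ⊕ ρ₃
  ∩+₁ : ∀ {ρ₁ ρ₂ ρ₃} → (ρ₁ ∩ ρ₂) ⊕ ρ₃ ≤ (ρ₁ ⊕ ρ₃) ∩ (ρ₂ ⊕ ρ₃)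
  ∩+₂ : ∀ {ρ₁ ρ₂ ρ₃} → (ρ₁ ⊕ ρ₃) ∩ (ρ₂ ⊕ ρ₃) ≤ (ρ₁ ∩ ρ₂) ⊕ ρ₃
  fld+same₁ : ∀ {l σ τ ρ} → ⟨ l ∶ σ ⟩ ⊕ (⟨ l ∶ τ ⟩ ∩ ρ) ≤ ⟨ l ∶ τ ⟩ ∩ ⌊ ρ ⌋
  fld+same₂ : ∀ {l σ τ ρ} → ⟨ l ∶ τ ⟩ ∩ ⌊ ρ ⌋ ≤ ⟨ l ∶ σ ⟩ ⊕ (⟨ l ∶ τ ⟩ ∩ ρ)
  fld+diff₁ : ∀ {l l′ σ τ ρ} → l ≢ l′ →
              ⟨ l ∶ σ ⟩ ⊕ (⟨ l′ ∶ τ ⟩ ∩ ρ) ≤ ⟨ l′ ∶ τ ⟩ ∩ (⟨ l ∶ σ ⟩ ⊕ ρ)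
  fld+diff₂ : ∀ {l l′ σ τ ρ} → l ≢ l′ →
              ⟨ l′ ∶ τ ⟩ ∩ (⟨ l ∶ σ ⟩ ⊕ ρ) ≤ ⟨ l ∶ σ ⟩ ⊕ (⟨ l′ ∶ τ ⟩ ∩ ρ)
  +-monoˡ : ∀ {ρ₁ ρ₂ ρ} → ⌊ ρ₁ ⌋ ≤ ⌊ ρ₂ ⌋ → ρ₁ ⊕ ρ ≤ ρ₂ ⊕ ρ
  +-congʳ₁ : ∀ {ρ₁ ρ₂ ρ} → ⌊ ρ₁ ⌋ ≤ ⌊ ρ₂ ⌋ → ⌊ ρ₂ ⌋ ≤ ⌊ ρ₁ ⌋ → ρ ⊕ ρ₁ ≤ ρ ⊕ ρ₂
  +-congʳ₂ : ∀ {ρ₁ ρ₂ ρ} → ⌊ ρ₁ ⌋ ≤ ⌊ ρ₂ ⌋ → ⌊ ρ₂ ⌋ ≤ ⌊ ρ₁ ⌋ → ρ ⊕ ρ₂ ≤ ρ ⊕ ρ₁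

infix 4 _≃_
_≃_ : Ty ty → Ty ty → Set
σ ≃ τ = (σ ≤ τ) × (τ ≤ σ)

-- Two inequalities hold for all record types: ρ₁ + ρ₂ ≤ ρ₂ (since ρ₁ ≤ ⟨⟩ and
-- ⟨⟩ + ρ₂ = ρ₂) and ρ₁ ∩ ρ₂ ≤ ρ₁ + ρ₂.  Hence ρ₁ + ρ₂ = ρ₁ ∩ ρ₂ amounts to
-- ρ₁ + ρ₂ ≤ ρ₁.  The second inequality is proved on flat record types
-- ⟨l₁:σ₁⟩ ∩ (⋯ ∩ ⟨⟩), where the field-update rules let each field of ρ₁ be
-- moved through ρ₂, after showing that every record type equals a flat one.
module Submission where

open import Data.Nat using (_≟_)
open import Data.Product using (_,_; proj₁; proj₂)
open import Function.Bundles using (_⇔_; mk⇔)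
open import Relation.Binary.PropositionalEquality using (refl)
open import Relation.Nullary using (yes; no)

open import Defs

infixr 3 _⨾_
_⨾_ : ∀ {σ τ υ} → σ ≤ τ → τ ≤ υ → σ ≤ υ
_⨾_ = ≤-trans

≃-refl : ∀ {σ} → σ ≃ σ
≃-refl = ≤-refl , ≤-refl

≃-trans : ∀ {σ τ υ} → σ ≃ τ → τ ≃ υ → σ ≃ υ
≃-trans (p , p′) (q , q′) = (p ⨾ q) , (q′ ⨾ p′)

∩-mono : ∀ {σ₁ σ₂ τ₁ τ₂} → σ₁ ≤ τ₁ → σ₂ ≤ τ₂ → σ₁ ∩ σ₂ ≤ τ₁ ∩ τ₂
∩-mono p q = ∩-glb (∩-l ⨾ p) (∩-r ⨾ q)

∩-cong : ∀ {σ₁ σ₂ τ₁ τ₂} → σ₁ ≃ τ₁ → σ₂ ≃ τ₂ → σ₁ ∩ σ₂ ≃ τ₁ ∩ τ₂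
∩-cong (p , p′) (q , q′) = ∩-mono p q , ∩-mono p′ q′

∩-assoc : ∀ {σ τ υ} → (σ ∩ τ) ∩ υ ≃ σ ∩ (τ ∩ υ)
∩-assoc = ∩-glb (∩-l ⨾ ∩-l) (∩-mono ∩-r ≤-refl)
        , ∩-glb (∩-mono ≤-refl ∩-l) (∩-r ⨾ ∩-r)

∩-exchange : ∀ {σ τ υ} → σ ∩ (τ ∩ υ) ≤ τ ∩ (σ ∩ υ)
∩-exchange = ∩-glb (∩-r ⨾ ∩-l) (∩-mono ≤-refl ∩-r)

∩-distribʳ : ∀ {σ τ υ} → (σ ∩ τ) ∩ υ ≤ (σ ∩ υ) ∩ (τ ∩ υ)
∩-distribʳ = ∩-glb (∩-mono ∩-l ≤-refl) (∩-mono ∩-r ≤-refl)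

⊕-congʳ : ∀ {ρ ρ₁ ρ₂} → ⌊ ρ₁ ⌋ ≃ ⌊ ρ₂ ⌋ → ρ ⊕ ρ₁ ≃ ρ ⊕ ρ₂
⊕-congʳ (p , q) = +-congʳ₁ p q , +-congʳ₂ p q

rec≤⟨⟩ : ∀ ρ → ⌊ ρ ⌋ ≤ ⟨⟩
rec≤⟨⟩ (ρ₁ ∩ ρ₂) = ∩-l ⨾ rec≤⟨⟩ ρ₁
rec≤⟨⟩ ⟨⟩        = ≤-refl
rec≤⟨⟩ ⟨ l ∶ σ ⟩ = fld≤⟨⟩
rec≤⟨⟩ (ρ₁ ⊕ ρ₂) = +-monoˡ (rec≤⟨⟩ ρ₁) ⨾ ⟨⟩+₁ ⨾ rec≤⟨⟩ ρ₂

⊕-≤ʳ : ∀ ρ₁ ρ₂ → ρ₁ ⊕ ρ₂ ≤ ⌊ ρ₂ ⌋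
⊕-≤ʳ ρ₁ ρ₂ = +-monoˡ (rec≤⟨⟩ ρ₁) ⨾ ⟨⟩+₁

-- Labels may repeat; the field-update rules only act on this shape.
data Flat : Ty rc → Set where
  nil  : Flat ⟨⟩
  cons : ∀ l σ {ρ} → Flat ρ → Flat (⟨ l ∶ σ ⟩ ∩ ρ)

record Flattening (σ : Ty ty) : Set where
  constructor flattening
  field
    {nf}    : Ty rc
    nf-flat : Flat nf
    ≃nf     : σ ≃ ⌊ nf ⌋

≃-flattening : ∀ {σ τ} → σ ≃ τ → Flattening τ → Flattening σ
≃-flattening e (flattening f e′) = flattening f (≃-trans e e′)

fld∩-flattening : ∀ l σ {τ} → Flattening τ → Flattening (⟨ l ∶ σ ⟩ ∩ τ)
fld∩-flattening l σ (flattening f e) = flattening (cons l σ f) (∩-cong ≃-refl e)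

flat-∩ : ∀ {ρ₁ ρ₂} → Flat ρ₁ → Flat ρ₂ → Flattening (⌊ ρ₁ ⌋ ∩ ⌊ ρ₂ ⌋)
flat-∩ {ρ₂ = ρ₂} nil f₂ = flattening f₂ (∩-r , ∩-glb (rec≤⟨⟩ ρ₂) ≤-refl)
flat-∩ (cons l σ f₁) f₂ = ≃-flattening ∩-assoc (fld∩-flattening l σ (flat-∩ f₁ f₂))

∩-flattening : ∀ {σ τ} → Flattening σ → Flattening τ → Flattening (σ ∩ τ)
∩-flattening (flattening f₁ e₁) (flattening f₂ e₂) =
  ≃-flattening (∩-cong e₁ e₂) (flat-∩ f₁ f₂)

fld⊕-flattening : ∀ l σ {ρ} → Flat ρ → Flattening (⟨ l ∶ σ ⟩ ⊕ ρ)
fld⊕-flattening l σ nil =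
  flattening (cons l σ nil) ((+⟨⟩₁ ⨾ ∩-glb ≤-refl fld≤⟨⟩) , (∩-l ⨾ +⟨⟩₂))
fld⊕-flattening l σ (cons l′ τ f) with l ≟ l′
... | yes refl = flattening (cons l τ f) (fld+same₁ , fld+same₂)
... | no l≢l′  = ≃-flattening (fld+diff₁ l≢l′ , fld+diff₂ l≢l′)
                   (fld∩-flattening l′ τ (fld⊕-flattening l σ f))

⊕-flattening : ∀ ρ₁ {ρ₂} → Flat ρ₂ → Flattening (ρ₁ ⊕ ρ₂)
⊕-flattening ⟨⟩ f = flattening f (⟨⟩+₁ , ⟨⟩+₂)
⊕-flattening ⟨ l ∶ σ ⟩ f = fld⊕-flattening l σ f
⊕-flattening (ρ ∩ ρ′) f =
  ≃-flattening (∩+₁ , ∩+₂) (∩-flattening (⊕-flattening ρ f) (⊕-flattening ρ′ f))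
⊕-flattening (ρ ⊕ ρ′) f with ⊕-flattening ρ′ f
... | flattening f′ e = ≃-flattening (≃-trans (+-assoc₁ , +-assoc₂) (⊕-congʳ e))
                                     (⊕-flattening ρ f′)

flatten : ∀ ρ → Flattening ⌊ ρ ⌋
flatten ρ = ≃-flattening (+⟨⟩₂ , +⟨⟩₁) (⊕-flattening ρ nil)

fld∩≤fld⊕ : ∀ l σ {ρ} → Flat ρ → ⟨ l ∶ σ ⟩ ∩ ⌊ ρ ⌋ ≤ ⟨ l ∶ σ ⟩ ⊕ ρ
fld∩≤fld⊕ l σ nil = ∩-l ⨾ +⟨⟩₂
fld∩≤fld⊕ l σ (cons l′ τ f) with l ≟ l′
... | yes refl = ∩-r ⨾ fld+same₂
... | no l≢l′  = ∩-exchange ⨾ ∩-mono ≤-refl (fld∩≤fld⊕ l σ f) ⨾ fld+diff₂ l≢l′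

flat-∩≤⊕ : ∀ {ρ₁ ρ₂} → Flat ρ₁ → Flat ρ₂ → ⌊ ρ₁ ⌋ ∩ ⌊ ρ₂ ⌋ ≤ ρ₁ ⊕ ρ₂
flat-∩≤⊕ nil f₂ = ∩-r ⨾ ⟨⟩+₂
flat-∩≤⊕ (cons l σ f₁) f₂ =
  ∩-distribʳ ⨾ ∩-mono (fld∩≤fld⊕ l σ f₂) (flat-∩≤⊕ f₁ f₂) ⨾ ∩+₂

∩≤⊕ : ∀ ρ₁ ρ₂ → ⌊ ρ₁ ⌋ ∩ ⌊ ρ₂ ⌋ ≤ ρ₁ ⊕ ρ₂
∩≤⊕ ρ₁ ρ₂ with flatten ρ₁ | flatten ρ₂
... | flattening f₁ (p₁ , q₁) | flattening f₂ e₂ =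
  ∩-mono p₁ (proj₁ e₂) ⨾ flat-∩≤⊕ f₁ f₂ ⨾ +-monoˡ q₁ ⨾ proj₂ (⊕-congʳ e₂)

lemma3p9 : (ρ₁ ρ₂ : Ty rc) → (⌊ ρ₁ ⊕ ρ₂ ⌋ ≃ ⌊ ρ₁ ⌋ ∩ ⌊ ρ₂ ⌋) ⇔ (⌊ ρ₁ ⊕ ρ₂ ⌋ ≤ ⌊ ρ₁ ⌋)
lemma3p9 ρ₁ ρ₂ = mk⇔
  (λ ⊕≃∩ → proj₁ ⊕≃∩ ⨾ ∩-l)
  (λ ⊕≤ρ₁ → ∩-glb ⊕≤ρ₁ (⊕-≤ʳ ρ₁ ρ₂) , ∩≤⊕ ρ₁ ρ₂)
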